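{- Let $\mathbf{A}=\langle A,\cdot,\lnot\rangle$ be an a-involutive left-normal band. Then $\mathbf{A}\vDash x\cdot\lnot x\cdot y\approx x\cdot\lnot x\cdot\lnot y$ if and only if $\mathbf{A}/\mathcal{D}\in\mathcal{RBISL}$.
   Context: A band is an idempotent semigroup; it is left-normal if it satisfies $xyz\approx xzy$. An a-involutive band is an algebra $\langle A,\cdot,\lnot\rangle$ where $\langle A,\cdot\rangle$ is a band, $\lnot\lnot x\approx x$, and $\lnot(x\cdot y)\approx \lnot x\cdot\lnot y$. Green's relation $\mathcal{D}$ on a band is defined by $a\,\mathcal{D}\,b$ iff $aba=a$ and $bab=b$; for an a-involutive left-normal band, $\mathcal{D}$ is a congruence of $\langle A,\cdot,\lnot\rangle$ and $\mathbf{A}/\mathcal{D}$ is an involutive semilattice (a semilattice $\langle I,\lor\rangle$ with an operation $\lnot$ satisfying $\lnot\lnot x\approx x$ and $\lnot(x\lor y)\approx\lnot x\lor\lnot y$). $\mathcal{RBISL}$ is the variety of involutive semilattices satisfying $(x\lor\lnot x)\lor y\approx(x\lor\lnot x)\lor \lnot y$. -}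

module Defs where

open import Level using (Level; suc; _⊔_)
open import Relation.Binary.PropositionalEquality using (_≡_)
open import Data.Product using (_×_)

record AInvolutiveBand (a : Level) : Set (suc a) where
  infixl 7 _·_
  field
    Carrier : Set a
    _·_     : Carrier → Carrier → Carrier
    ¬_      : Carrier → Carrier
    ·-assoc : ∀ x y z → (x · y) · z ≡ x · (y · z)
    ·-idem  : ∀ x → x · x ≡ x
    ¬-invol : ∀ x → ¬ (¬ x) ≡ x
    ¬-hom   : ∀ x y → ¬ (x · y) ≡ (¬ x) · (¬ y)

IsLeftNormal : ∀ {a} → AInvolutiveBand a → Set a
IsLeftNormal A = ∀ x y z → x · y · z ≡ x · z · y
  where open AInvolutiveBand A

module _ {a} (A : AInvolutiveBand a) where
  open AInvolutiveBand A

  GreenD : Carrier → Carrier → Set a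
  GreenD x y = (x · y · x ≡ x) × (y · x · y ≡ y)

  SatisfiesXNotXIdentity : Set a
  SatisfiesXNotXIdentity = ∀ x y → x · (¬ x) · y ≡ x · (¬ x) · (¬ y)

  -- The semilattice join on A/D is [x]∨[y] = [x·y] and
  -- ¬[x] = [¬x]; A/D is an involutive semilattice (context), so
  -- membership in RBISL amounts to A/D satisfying
  -- (x ∨ ¬x) ∨ y ≈ (x ∨ ¬x) ∨ ¬y, i.e. the identity holding in A modulo D
  -- (every element of A/D is a class [x]).
  QuotientByDInRBISL : Set a
  QuotientByDInRBISL = ∀ x y → GreenD ((x · (¬ x)) · y) ((x · (¬ x)) · (¬ y))

{-# OPTIONS --safe #-}
module Submission where

open import Defs
open import Level using (Level)
open import Function.Bundles using (_⇔_; mk⇔)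
open import Data.Product using (_,_)
open import Relation.Binary.PropositionalEquality
  using (_≡_; sym; trans; cong; subst; module ≡-Reasoning)

-- In a left-normal band all elements p·b of a principal right
-- ideal p·A commute, and D-related elements that commute are equal.  Hence
-- x¬x·y and x¬x·¬y are D-related exactly when they are equal.

module BandProperties {a} (A : AInvolutiveBand a) where

  open AInvolutiveBand A
  open ≡-Reasoning

  GreenD-refl : ∀ x → GreenD A x x
  GreenD-refl x = x·x·x≡x , x·x·x≡x
    where
    x·x·x≡x : x · x · x ≡ x
    x·x·x≡x = trans (cong (_· x) (·-idem x)) (·-idem x)

  x·y·x≡x∧comm⇒x≡y·x : ∀ {x y} → x · y · x ≡ x → x · y ≡ y · x → x ≡ y · x
  x·y·x≡x∧comm⇒x≡y·x {x} {y} xyx≡x xy≡yx = begin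
    x           ≡⟨ sym xyx≡x ⟩
    x · y · x   ≡⟨ cong (_· x) xy≡yx ⟩
    y · x · x   ≡⟨ ·-assoc y x x ⟩
    y · (x · x) ≡⟨ cong (y ·_) (·-idem x) ⟩
    y · x       ∎

  D-related∧comm⇒≡ : ∀ {x y} → GreenD A x y → x · y ≡ y · x → x ≡ y
  D-related∧comm⇒≡ {x} {y} (xyx≡x , yxy≡y) xy≡yx = begin
    x     ≡⟨ x·y·x≡x∧comm⇒x≡y·x xyx≡x xy≡yx ⟩
    y · x ≡⟨ sym xy≡yx ⟩
    x · y ≡⟨ sym (x·y·x≡x∧comm⇒x≡y·x yxy≡y (sym xy≡yx)) ⟩
    y     ∎

  module LeftNormal (left-normal : IsLeftNormal A) where

    left-regular : ∀ x y → x · y · x ≡ x · y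
    left-regular x y = trans (left-normal x y x) (cong (_· y) (·-idem x))

    ·-absorbs-prefix : ∀ p x y → p · x · (p · y) ≡ p · x · y
    ·-absorbs-prefix p x y = begin
      p · x · (p · y) ≡⟨ sym (·-assoc (p · x) p y) ⟩
      p · x · p · y   ≡⟨ cong (_· y) (left-regular p x) ⟩
      p · x · y       ∎

    prefixed-comm : ∀ p x y → p · x · (p · y) ≡ p · y · (p · x)
    prefixed-comm p x y = begin
      p · x · (p · y) ≡⟨ ·-absorbs-prefix p x y ⟩
      p · x · y       ≡⟨ left-normal p x y ⟩
      p · y · x       ≡⟨ sym (·-absorbs-prefix p y x) ⟩
      p · y · (p · x) ∎

lemma3p7 : ∀ {a : Level} (A : AInvolutiveBand a) → IsLeftNormal A →
    SatisfiesXNotXIdentity A ⇔ QuotientByDInRBISL A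
lemma3p7 A left-normal = mk⇔ identity⇒modulo-D modulo-D⇒identity
  where
  open AInvolutiveBand A
  open BandProperties A
  open LeftNormal left-normal

  identity⇒modulo-D : SatisfiesXNotXIdentity A → QuotientByDInRBISL A
  identity⇒modulo-D identity x y =
    subst (GreenD A (x · ¬ x · y)) (identity x y) (GreenD-refl (x · ¬ x · y))

  modulo-D⇒identity : QuotientByDInRBISL A → SatisfiesXNotXIdentity A
  modulo-D⇒identity modulo-D x y =
    D-related∧comm⇒≡ (modulo-D x y) (prefixed-comm (x · ¬ x) y (¬ y))
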